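{- Let $t,t',\Delta\in\mathbb{N}$ with $t\le t'$. If $A$ $(t,\Delta)$-approximates $B$, then there exists $u\in(t-\Delta,t]$ such that $A$ $(t',\Delta)$-approximates $B\cap[u]$.
   Context: $\mathbb{N}=\{0,1,2,\dots\}$, $[t]=\{0,1,\dots,t\}$. For $A\subseteq[t]$ and $b\in\mathbb{N}$ define $\mathrm{apx}^-_t(b,A)=\max\{a\in A\cup\{t+1\}\mid a\le b\}$ and $\mathrm{apx}^+_t(b,A)=\min\{a\in A\cup\{t+1\}\mid a\ge b\}$, with $\max\emptyset=-\infty$, $\min\emptyset=\infty$. "$A$ $(t,\Delta)$-approximates $B$" means $A\subseteq B\subseteq[t]$ and for every $b\in B$, $\mathrm{apx}^+_t(b,A)-\mathrm{apx}^-_t(b,A)\le\Delta$. -}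

module Defs where

open import Data.Nat using (ℕ; zero; suc; _∸_; _≤_; _<_; _+_; _≤ᵇ_; _≡ᵇ_)
open import Data.Bool using (Bool; true; false; if_then_else_; _∨_; _∧_; T)
open import Data.Maybe using (Maybe; just; nothing)
open import Data.Product using (Σ; _×_)
open import Relation.Binary.PropositionalEquality using (_≡_)

Subset : Set
Subset = ℕ → Bool

_∈_ : ℕ → Subset → Set
x ∈ S = T (S x)

_⊆_ : Subset → Subset → Set
S ⊆ S' = ∀ x → x ∈ S → x ∈ S'

_⊆[_] : Subset → ℕ → Set
S ⊆[ t ] = ∀ x → x ∈ S → x ≤ t

_∩[_] : Subset → ℕ → Subset
(B ∩[ u ]) x = B x ∧ (x ≤ᵇ u)

inA⁺ : ℕ → Subset → ℕ → Bool
inA⁺ t A a = A a ∨ (a ≡ᵇ suc t)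

-- largest a ≤ n with a ∈ A ∪ {t+1}; nothing encodes -∞
searchDown : ℕ → Subset → ℕ → Maybe ℕ
searchDown t A zero = if inA⁺ t A zero then just zero else nothing
searchDown t A (suc n) = if inA⁺ t A (suc n) then just (suc n) else searchDown t A n

searchUp : ℕ → Subset → ℕ → ℕ → Maybe ℕ
searchUp t A b zero = if inA⁺ t A b then just b else nothing
searchUp t A b (suc k) = if inA⁺ t A b then just b else searchUp t A (suc b) k

-- apx⁻_t(b,A) = max{a ∈ A ∪ {t+1} | a ≤ b}  (nothing = -∞)
apx⁻ : ℕ → ℕ → Subset → Maybe ℕ
apx⁻ t b A = searchDown t A b

-- apx⁺_t(b,A) = min{a ∈ A ∪ {t+1} | a ≥ b}  (nothing = ∞)
apx⁺ : ℕ → ℕ → Subset → Maybe ℕ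
apx⁺ t b A = if b ≤ᵇ suc t then searchUp t A b (suc t ∸ b) else nothing

-- apx⁺ - apx⁻ ≤ Δ; this forces both to be finite (∞ - x = x - (-∞) = ∞)
GapAtMost : Maybe ℕ → Maybe ℕ → ℕ → Set
GapAtMost (just p) (just q) Δ = p ∸ q ≤ Δ
GapAtMost _ _ Δ = ⊥′
  where open import Data.Empty using () renaming (⊥ to ⊥′)

Approximates : ℕ → ℕ → Subset → Subset → Set
Approximates t Δ A B =
  (A ⊆ B) × (B ⊆[ t ]) ×
  (∀ b → b ∈ B → GapAtMost (apx⁺ t b A) (apx⁻ t b A) Δ)

-- Let m be the largest element of A.  If t − Δ < m, take u = m: every b ≤ m has m above it
-- in A.  Otherwise (or if A = ∅) take u = t − Δ + 1: then apx⁻_t(b,A) ≤ m, so apx⁺_t(b,A) ≤ m + Δ ≤ t, and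
-- again some element of A lies above b.  In both cases the sentinel t+1 never enters the
-- approximation of any b ∈ B ∩ [u], so apx⁻ and apx⁺ do not change when t grows to t′.
module Submission where

open import Defs
open import Data.Nat using (ℕ; _≤_; _<_; _+_)
open import Data.Product using (Σ; _×_)

open import Data.Nat using (zero; suc; _∸_; _≤ᵇ_; _≡ᵇ_; z≤n; s≤s; s≤s⁻¹)
open import Data.Nat.Properties
open import Data.Bool using (true; false; T; if_then_else_)
open import Data.Bool.Properties using (∨-identityʳ)
open import Data.Maybe using (just)
open import Data.Product using (_,_; proj₂)
open import Data.Sum using (_⊎_; inj₁; inj₂)
open import Data.Unit using (tt)
open import Data.Empty using (⊥; ⊥-elim)
open import Relation.Binary.PropositionalEquality
open import Relation.Nullary using (yes; no)

Dominated : Subset → ℕ → Set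
Dominated A b = Σ ℕ (λ a → a ∈ A × b ≤ a)

∈-∩[]⁺ : ∀ {B u b} → b ∈ B → b ≤ u → b ∈ (B ∩[ u ])
∈-∩[]⁺ {B} {b = b} b∈B b≤u with B b
... | true = ≤⇒≤ᵇ b≤u

∈-∩[]⁻ : ∀ {B u b} → b ∈ (B ∩[ u ]) → b ∈ B × b ≤ u
∈-∩[]⁻ {B} {u} {b} b∈B∩u with B b
... | true = tt , ≤ᵇ⇒≤ b u b∈B∩u

≤-below-∉ : ∀ A {n x} → A (suc n) ≡ false → x ∈ A → x ≤ suc n → x ≤ n
≤-below-∉ A An x∈A x≤1+n = s≤s⁻¹ (≤∧≢⇒< x≤1+n λ { refl → subst T An x∈A })

approximates-⊆[] : ∀ {t Δ A B} → Approximates t Δ A B → A ⊆[ t ]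
approximates-⊆[] (A⊆B , B⊆t , _) a a∈A = B⊆t a (A⊆B a a∈A)

greatest-or-empty : (A : Subset) (n : ℕ) →
  Σ ℕ (λ m → m ∈ A × m ≤ n × (∀ x → x ∈ A → x ≤ n → x ≤ m)) ⊎ (∀ x → x ∈ A → x ≤ n → ⊥)
greatest-or-empty A n with A n in An
... | true = inj₁ (n , subst T (sym An) tt , ≤-refl , λ _ _ x≤n → x≤n)
greatest-or-empty A zero | false = inj₂ λ { .zero x∈A z≤n → subst T An x∈A }
greatest-or-empty A (suc n) | false with greatest-or-empty A n
... | inj₁ (m , m∈A , m≤n , m-max) =
  inj₁ (m , m∈A , m≤n⇒m≤1+n m≤n , λ x x∈A x≤1+n → m-max x x∈A (≤-below-∉ A An x∈A x≤1+n))
... | inj₂ none = inj₂ λ x x∈A x≤1+n → none x x∈A (≤-below-∉ A An x∈A x≤1+n)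

inA⁺-below : ∀ {t A x} → x ≤ t → inA⁺ t A x ≡ A x
inA⁺-below {t} {A} {x} x≤t with x ≡ᵇ suc t in eq
... | true = ⊥-elim (<-irrefl (≡ᵇ⇒≡ x (suc t) (subst T (sym eq) tt)) (s≤s x≤t))
... | false = ∨-identityʳ (A x)

inA⁺-below⇒∈ : ∀ {t A x} → x ≤ t → T (inA⁺ t A x) → x ∈ A
inA⁺-below⇒∈ {A = A} x≤t = subst T (inA⁺-below {A = A} x≤t)

searchDown-sound : ∀ {t A} n {q} → searchDown t A n ≡ just q → q ≤ n × T (inA⁺ t A q)
searchDown-sound {t} {A} zero e with inA⁺ t A zero in hit
searchDown-sound zero refl | true = z≤n , subst T (sym hit) tt
searchDown-sound {t} {A} (suc n) e with inA⁺ t A (suc n) in hit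
searchDown-sound (suc n) refl | true = ≤-refl , subst T (sym hit) tt
... | false with searchDown-sound n e
... | q≤n , q∈A⁺ = m≤n⇒m≤1+n q≤n , q∈A⁺

searchDown-below : ∀ {t t′ A} n → n ≤ t → n ≤ t′ → searchDown t A n ≡ searchDown t′ A n
searchDown-below zero n≤t n≤t′ = refl
searchDown-below {A = A} (suc n) n≤t n≤t′
  rewrite inA⁺-below {A = A} n≤t | inA⁺-below {A = A} n≤t′ =
  cong (if A (suc n) then just (suc n) else_)
       (searchDown-below n (<⇒≤ n≤t) (<⇒≤ n≤t′))

searchUp-sound : ∀ {t A} b k {p} → searchUp t A b k ≡ just p → b ≤ p × T (inA⁺ t A p)
searchUp-sound {t} {A} b zero e with inA⁺ t A b in hit
searchUp-sound b zero refl | true = ≤-refl , subst T (sym hit) tt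
searchUp-sound {t} {A} b (suc k) e with inA⁺ t A b in hit
searchUp-sound b (suc k) refl | true = ≤-refl , subst T (sym hit) tt
... | false with searchUp-sound (suc b) k e
... | 1+b≤p , p∈A⁺ = <⇒≤ 1+b≤p , p∈A⁺

searchUp-hit : ∀ {t A b} k → b ∈ A → searchUp t A b k ≡ just b
searchUp-hit {A = A} {b} zero b∈A with A b
... | true = refl
searchUp-hit {A = A} {b} (suc k) b∈A with A b
... | true = refl

searchUp-miss : ∀ {t A b} k → A b ≡ false → b ≤ t →
  searchUp t A b (suc k) ≡ searchUp t A (suc b) k
searchUp-miss {A = A} k Ab b≤t rewrite inA⁺-below {A = A} b≤t | Ab = refl

-- Both searches return the least element of A in [b, x]; the sentinels t+1 and t′+1 lie beyond x.
searchUp-agree : ∀ {t t′ A x} b k k′ → x ∈ A → b ≤ x → x ≤ t → x ≤ t′ →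
  x ≤ b + k → x ≤ b + k′ → searchUp t A b k ≡ searchUp t′ A b k′
searchUp-agree {A = A} {x} b k k′ x∈A b≤x x≤t x≤t′ x≤b+k x≤b+k′ with A b in Ab
... | true = trans (searchUp-hit k b∈A) (sym (searchUp-hit k′ b∈A))
  where
  b∈A : b ∈ A
  b∈A = subst T (sym Ab) tt
searchUp-agree b zero k′ x∈A b≤x x≤t x≤t′ x≤b+0 x≤b+k′ | false
  with ≤-antisym b≤x (subst (_ ≤_) (+-identityʳ b) x≤b+0)
... | refl = ⊥-elim (subst T Ab x∈A)
searchUp-agree b (suc k) zero x∈A b≤x x≤t x≤t′ x≤b+k x≤b+0 | false
  with ≤-antisym b≤x (subst (_ ≤_) (+-identityʳ b) x≤b+0)
... | refl = ⊥-elim (subst T Ab x∈A)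
searchUp-agree {x = x} b (suc k) (suc k′) x∈A b≤x x≤t x≤t′ x≤b+k x≤b+k′ | false = begin
  searchUp _ _ b (suc k)        ≡⟨ searchUp-miss k Ab (≤-trans b≤x x≤t) ⟩
  searchUp _ _ (suc b) k        ≡⟨ searchUp-agree (suc b) k k′ x∈A b<x x≤t x≤t′
                                     (subst (x ≤_) (+-suc b k) x≤b+k)
                                     (subst (x ≤_) (+-suc b k′) x≤b+k′) ⟩
  searchUp _ _ (suc b) k′       ≡⟨ sym (searchUp-miss k′ Ab (≤-trans b≤x x≤t′)) ⟩
  searchUp _ _ b (suc k′)       ∎
  where
  open ≡-Reasoning
  b<x : b < x
  b<x = ≤∧≢⇒< b≤x λ { refl → subst T Ab x∈A }

apx⁺-unfold : ∀ {t A b} → b ≤ suc t → apx⁺ t b A ≡ searchUp t A b (suc t ∸ b)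
apx⁺-unfold {t} {b = b} b≤1+t with b ≤ᵇ suc t | ≤⇒≤ᵇ b≤1+t
... | true | _ = refl

apx⁻-sound : ∀ {t A b q} → apx⁻ t b A ≡ just q → b ≤ t → q ≤ b × q ∈ A
apx⁻-sound {A = A} {b} e b≤t with searchDown-sound b e
... | q≤b , q∈A⁺ = q≤b , inA⁺-below⇒∈ {A = A} (≤-trans q≤b b≤t) q∈A⁺

apx⁺-sound : ∀ {t A b p} → apx⁺ t b A ≡ just p → b ≤ t → b ≤ p × T (inA⁺ t A p)
apx⁺-sound {t} {A} {b} e b≤t =
  searchUp-sound {t} {A} b (suc t ∸ b) (trans (sym (apx⁺-unfold (m≤n⇒m≤1+n b≤t))) e)

apx⁻-stable : ∀ {t t′ A b} → b ≤ t → t ≤ t′ → apx⁻ t b A ≡ apx⁻ t′ b A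
apx⁻-stable {b = b} b≤t t≤t′ = searchDown-below b b≤t (≤-trans b≤t t≤t′)

apx⁺-stable : ∀ {t t′ A b} → Dominated A b → A ⊆[ t ] → t ≤ t′ →
  apx⁺ t b A ≡ apx⁺ t′ b A
apx⁺-stable {t} {t′} {b = b} (x , x∈A , b≤x) A⊆t t≤t′ = begin
  apx⁺ t b _                      ≡⟨ apx⁺-unfold (m≤n⇒m≤1+n b≤t) ⟩
  searchUp t _ b (suc t ∸ b)      ≡⟨ searchUp-agree b _ _ x∈A b≤x x≤t x≤t′
                                       (x≤b+[1+s∸b] x≤t) (x≤b+[1+s∸b] x≤t′) ⟩
  searchUp t′ _ b (suc t′ ∸ b)    ≡⟨ sym (apx⁺-unfold (m≤n⇒m≤1+n (≤-trans b≤t t≤t′))) ⟩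
  apx⁺ t′ b _                     ∎
  where
  open ≡-Reasoning
  x≤t : x ≤ t
  x≤t = A⊆t x x∈A
  b≤t : b ≤ t
  b≤t = ≤-trans b≤x x≤t
  x≤t′ : x ≤ t′
  x≤t′ = ≤-trans x≤t t≤t′
  x≤b+[1+s∸b] : ∀ {s} → x ≤ s → x ≤ b + (suc s ∸ b)
  x≤b+[1+s∸b] x≤s = subst (x ≤_) (sym (m+[n∸m]≡n (m≤n⇒m≤1+n (≤-trans b≤x x≤s))))
                          (m≤n⇒m≤1+n x≤s)

gap-just : ∀ {mp mq Δ} → GapAtMost mp mq Δ →
  Σ ℕ (λ p → Σ ℕ (λ q → mp ≡ just p × mq ≡ just q × p ∸ q ≤ Δ))
gap-just {just p} {just q} p∸q≤Δ = p , q , refl , refl , p∸q≤Δ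

approximates-restrict : ∀ {t t′ Δ A B u} → Approximates t Δ A B → t ≤ t′ → u ≤ t →
  A ⊆[ u ] → (∀ b → b ∈ B → b ≤ u → Dominated A b) → Approximates t′ Δ A (B ∩[ u ])
approximates-restrict {t} {t′} {Δ} {A} {B} {u} (A⊆B , B⊆t , gap) t≤t′ u≤t A⊆u dom =
  (λ a a∈A → ∈-∩[]⁺ {B} (A⊆B a a∈A) (A⊆u a a∈A)) ,
  (λ b b∈B∩u → ≤-trans (proj₂ (∈-∩[]⁻ {B} b∈B∩u)) (≤-trans u≤t t≤t′)) ,
  gap′
  where
  gap′ : ∀ b → b ∈ (B ∩[ u ]) → GapAtMost (apx⁺ t′ b A) (apx⁻ t′ b A) Δ
  gap′ b b∈B∩u with ∈-∩[]⁻ {B} b∈B∩u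
  ... | b∈B , b≤u =
    subst₂ (λ p q → GapAtMost p q Δ)
      (apx⁺-stable (dom b b∈B b≤u) (λ a a∈A → B⊆t a (A⊆B a a∈A)) t≤t′)
      (apx⁻-stable (B⊆t b b∈B) t≤t′)
      (gap b b∈B)

-- The sentinel t+1 is out of reach of apx⁻ + Δ, so apx⁺ lands in A.
dominated-if-top-sparse : ∀ {t Δ A B} → Approximates t Δ A B →
  (∀ a → a ∈ A → a + Δ ≤ t) → ∀ b → b ∈ B → Dominated A b
dominated-if-top-sparse {t} {Δ} {A} (A⊆B , B⊆t , gap) sparse b b∈B
  with gap-just (gap b b∈B)
... | p , q , apx⁺≡p , apx⁻≡q , p∸q≤Δ with apx⁻-sound apx⁻≡q (B⊆t b b∈B)
... | q≤b , q∈A with apx⁺-sound apx⁺≡p (B⊆t b b∈B)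
... | b≤p , p∈A⁺ = p , inA⁺-below⇒∈ {A = A} p≤t p∈A⁺ , b≤p
  where
  p≤t : p ≤ t
  p≤t = ≤-trans (≤-trans (m≤n+m∸n p q) (+-monoʳ-≤ q p∸q≤Δ)) (sparse q q∈A)

cut-if-top-sparse : ∀ {t t′ d A B} → Approximates t (suc d) A B → t ≤ t′ →
  (∀ a → a ∈ A → a + suc d ≤ t) →
  Σ ℕ (λ u → (t < u + suc d) × (u ≤ t) × Approximates t′ (suc d) A (B ∩[ u ]))
cut-if-top-sparse {t} {d = d} ap t≤t′ sparse =
  t ∸ d , t<u+Δ , m∸n≤m t d ,
  approximates-restrict ap t≤t′ (m∸n≤m t d) A⊆u
    (λ b b∈B _ → dominated-if-top-sparse ap sparse b b∈B)
  where
  t<u+Δ : t < t ∸ d + suc d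
  t<u+Δ = subst (t <_) (sym (+-suc (t ∸ d) d))
            (s≤s (subst (t ≤_) (+-comm d (t ∸ d)) (m≤n+m∸n t d)))
  A⊆u : _ ⊆[ t ∸ d ]
  A⊆u a a∈A = m+n≤o⇒m≤o∸n a (≤-trans (+-monoʳ-≤ a (n≤1+n d)) (sparse a a∈A))

lemma4p9 : (t t′ Δ : ℕ) → 1 ≤ Δ → t ≤ t′ → (A B : Subset) →
    Approximates t Δ A B →
    Σ ℕ (λ u → (t < u + Δ) × (u ≤ t) × Approximates t′ Δ A (B ∩[ u ]))
lemma4p9 t t′ (suc d) _ t≤t′ A B ap with greatest-or-empty A t
... | inj₂ empty =
  cut-if-top-sparse ap t≤t′ λ a a∈A → ⊥-elim (empty a a∈A (approximates-⊆[] ap a a∈A))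
... | inj₁ (m , m∈A , m≤t , m-max) with t <? m + suc d
...   | yes t<m+Δ =
  m , t<m+Δ , m≤t ,
  approximates-restrict ap t≤t′ m≤t (λ a a∈A → m-max a a∈A (approximates-⊆[] ap a a∈A))
    (λ _ _ b≤m → m , m∈A , b≤m)
...   | no t≮m+Δ =
  cut-if-top-sparse ap t≤t′ λ a a∈A →
    ≤-trans (+-monoˡ-≤ (suc d) (m-max a a∈A (approximates-⊆[] ap a a∈A))) (≮⇒≥ t≮m+Δ)
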